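{- For any permutation $\sigma\in\mathfrak S_n$, with $\tau=\Phi(\sigma)$, $$\sum_{i=1}^n|\sigma_i-i|=2\big([21](\tau)+[2,31](\tau)+[31,2](\tau)\big).$$
   Context: The fundamental bijection $\Phi$: write $\sigma$ in cycle notation with each cycle beginning with its largest element and cycles ordered by increasing largest element; erasing parentheses gives the one-line notation of $\Phi(\sigma)$. For $\tau\in\mathfrak S_n$: $[21](\tau)$ is the number of positions $j$ with $\tau_j>\tau_{j+1}$; $[2,31](\tau)$ is the number of pairs of positions $i<j$ with $\tau_{j+1}<\tau_i<\tau_j$; $[31,2](\tau)$ is the number of pairs of positions $i,j$ with $i+1<j$ and $\tau_{i+1}<\tau_j<\tau_i$. -}

module Defs where

open import Data.Nat using (ℕ; zero; suc; _+_; _*_; _<ᵇ_; _≡ᵇ_; ∣_-_∣)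
open import Data.Bool using (Bool; true; false; _∧_; if_then_else_)
open import Data.List using (List; []; _∷_; _++_; map; length; upTo; concatMap; foldr)
open import Data.Nat.ListAction using (sum)
open import Data.Fin using (Fin; toℕ)
open import Data.Fin.Permutation using (Permutation′; _⟨$⟩ʳ_)
open import Data.List using (allFin)

-- Permutations of {1,…,n} are modelled as permutations of Fin n = {0,…,n-1};
-- values are reported 1-based (toℕ x + 1) in one-line notation.

val : ∀ {n} → Fin n → ℕ
val x = suc (toℕ x)

orbitGo : ∀ {n} → Permutation′ n → ℕ → Fin n → Fin n → List (Fin n)
orbitGo σ zero    m x = []
orbitGo σ (suc k) m x with toℕ x ≡ᵇ toℕ m
... | true  = []
... | false = x ∷ orbitGo σ k m (σ ⟨$⟩ʳ x)

cycleOf : ∀ {n} → Permutation′ n → Fin n → List (Fin n)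
cycleOf {n} σ m = m ∷ orbitGo σ n m (σ ⟨$⟩ʳ m)

isCycleMax : ∀ {n} → Permutation′ n → Fin n → Bool
isCycleMax σ m = foldr (λ y b → (toℕ y <ᵇ suc (toℕ m)) ∧ b) true (cycleOf σ m)

-- Fundamental bijection Φ: cycles begin with their largest element, ordered by
-- increasing largest element; erase parentheses.
Φ : ∀ {n} → Permutation′ n → List ℕ
Φ {n} σ = concatMap (λ m → if isCycleMax σ m then map val (cycleOf σ m) else [])
                    (allFin n)

-- 0-indexed lookup into a word (default 0, never used for in-range indices)
at : List ℕ → ℕ → ℕ
at []       _       = 0
at (x ∷ xs) zero    = x
at (x ∷ xs) (suc i) = at xs i

b2n : Bool → ℕ
b2n true  = 1
b2n false = 0

countBelow : ℕ → (ℕ → Bool) → ℕ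
countBelow N p = sum (map (λ k → b2n (p k)) (upTo N))

pat21 : List ℕ → ℕ
pat21 τ = countBelow (length τ) (λ j →
  (suc j <ᵇ length τ) ∧ (at τ (suc j) <ᵇ at τ j))

pat2-31 : List ℕ → ℕ
pat2-31 τ =
  sum (map (λ i → countBelow (length τ) (λ j →
    (i <ᵇ j) ∧ (suc j <ᵇ length τ) ∧
    (at τ (suc j) <ᵇ at τ i) ∧ (at τ i <ᵇ at τ j))) (upTo (length τ)))

pat31-2 : List ℕ → ℕ
pat31-2 τ =
  sum (map (λ i → countBelow (length τ) (λ j →
    (suc i <ᵇ j) ∧
    (at τ (suc i) <ᵇ at τ j) ∧ (at τ j <ᵇ at τ i))) (upTo (length τ)))

displacement : ∀ {n} → Permutation′ n → ℕ
displacement {n} σ = sum (map (λ i → ∣ toℕ (σ ⟨$⟩ʳ i) - toℕ i ∣) (allFin n))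

{-# OPTIONS --safe #-}
module Submission where

-- Put τ = Φ σ. A descent τⱼ > τⱼ₊₁ carries one occurrence of [21] and, for each of the
-- τⱼ − τⱼ₊₁ − 1 values strictly between τⱼ₊₁ and τⱼ, one occurrence of [2,31] or of
-- [31,2], according as that value sits before position j or after position j + 1. So the
-- pattern count is the total fall Σⱼ (τⱼ ∸ τⱼ₊₁) of τ. Read τ cycle by cycle: inside a
-- cycle consecutive letters are y, σ y; entering a cycle never falls, since cycles start at
-- their maxima and the maxima increase; and the last letter y of a cycle has σ y equal to
-- its maximum, so y ∸ σ y = 0. Hence the total fall is Σ_y (y ∸ σ y). Since σ permutes the
-- summands of Σ_y y, also Σ_y (σ y ∸ y) = Σ_y (y ∸ σ y), and Σ_y ∣σ y − y∣ is twice it.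

open import Defs
open import Data.Bool using (Bool; true; false; _∧_; not; if_then_else_; T)
open import Data.Bool.Properties using (∧-zeroʳ; T-∧; T-≡)
open import Data.Empty using (⊥-elim)
open import Data.Fin using (Fin; toℕ; zero; suc)
open import Data.Fin.Permutation using (Permutation′; _⟨$⟩ʳ_; _⟨$⟩ˡ_; inverseˡ)
import Data.Fin.Properties as Fin
open import Data.List as List
  using (List; []; _∷_; _++_; map; length; upTo; applyUpTo; concatMap; foldr; tabulate; allFin)
open import Data.List.Properties using (map-++; map-∘; map-concatMap; concatMap-cong)
open import Data.List.Membership.Propositional using (_∈_; _∉_)
open import Data.List.Membership.Propositional.Properties using (∈-applyUpTo⁺; ∈-applyUpTo⁻)
open import Data.List.Relation.Unary.Unique.Propositional.Properties using (applyUpTo⁺₁)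
open import Data.List.Relation.Unary.Any using (here; there)
open import Data.List.Relation.Unary.All as All using (All; []; _∷_)
open import Data.List.Relation.Unary.AllPairs using (AllPairs; []; _∷_)
open import Data.List.Relation.Unary.AllPairs.Properties using (tabulate⁺-<)
open import Data.List.Relation.Unary.Unique.Propositional using (Unique)
open import Data.Nat using (ℕ; zero; suc; _+_; _*_; _∸_; _≤_; _<_; z≤n; s≤s; _<ᵇ_; _≡ᵇ_; ∣_-_∣)
open import Data.Nat.Properties
open import Data.Nat.GeneralisedArithmetic using (iterate)
open import Data.Nat.DivMod using (_%_; _/_; m≡m%n+[m/n]*n; m%n<n)
open import Data.Nat.ListAction using (sum)
open import Data.Nat.ListAction.Properties using (sum-++)
open import Data.Sum using (inj₁; inj₂)
open import Data.Product using (∃-syntax; _×_; _,_)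
open import Function using (_∘_; id; Equivalence)
open import Relation.Nullary using (¬_; does; yes; no)
open import Relation.Nullary.Decidable using (dec-true; dec-false)
open import Relation.Binary.Definitions using (tri<; tri≈; tri>)
open import Relation.Binary.PropositionalEquality

open import Algebra.Properties.CommutativeMonoid.Sum +-0-commutativeMonoid
  using (sum-cong-≗; sum-replicate-zero; ∑-distrib-+; ∑-comm; ∑-permute; sum-syntax)
  renaming (sum to ∑)
open import Data.List.Extrema ≤-totalOrder using (argmax; argmax-all; f[xs]≤f[argmax])

sum-map-applyUpTo : ∀ (f g : ℕ → ℕ) n → sum (map f (applyUpTo g n)) ≡ ∑[ i < n ] f (g (toℕ i))
sum-map-applyUpTo f g zero    = refl
sum-map-applyUpTo f g (suc n) = cong (f (g 0) +_) (sum-map-applyUpTo f (g ∘ suc) n)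

sum-map-upTo : ∀ (f : ℕ → ℕ) n → sum (map f (upTo n)) ≡ ∑[ i < n ] f (toℕ i)
sum-map-upTo f = sum-map-applyUpTo f id

sum-map-tabulate : ∀ {A : Set} (f : A → ℕ) {n} (g : Fin n → A) →
                   sum (map f (tabulate g)) ≡ ∑[ i < n ] f (g i)
sum-map-tabulate f {zero}  g = refl
sum-map-tabulate f {suc n} g = cong (f (g zero) +_) (sum-map-tabulate f (g ∘ suc))

sum-map-allFin : ∀ {n} (f : Fin n → ℕ) → sum (map f (allFin n)) ≡ ∑[ i < n ] f i
sum-map-allFin f = sum-map-tabulate f id

sum-map-at : ∀ (h : ℕ → ℕ) τ → ∑[ k < length τ ] h (at τ (toℕ k)) ≡ sum (map h τ)
sum-map-at h []      = refl
sum-map-at h (x ∷ τ) = cong (h x +_) (sum-map-at h τ)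

∑-zero : ∀ {n} (f : Fin n → ℕ) → (∀ i → f i ≡ 0) → ∑[ i < n ] f i ≡ 0
∑-zero {n} f f≡0 = trans (sum-cong-≗ f≡0) (sum-replicate-zero n)

sum-map-++ : ∀ {A : Set} (h : A → ℕ) xs ys → sum (map h (xs ++ ys)) ≡ sum (map h xs) + sum (map h ys)
sum-map-++ h xs ys = trans (cong sum (map-++ h xs ys)) (sum-++ (map h xs) (map h ys))

iterate-applyUpTo : ∀ {A : Set} (f : A → A) x k → List.iterate f x k ≡ applyUpTo (iterate f x) k
iterate-applyUpTo f x zero    = refl
iterate-applyUpTo f x (suc k) = cong (x ∷_) (iterate-applyUpTo f (f x) k)

sum-map-iterate-suc : ∀ {A : Set} (h : A → ℕ) (f : A → A) x k →
  sum (map h (List.iterate f x (suc k))) ≡ sum (map h (List.iterate f x k)) + h (iterate f x k)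
sum-map-iterate-suc h f x zero    = +-identityʳ (h x)
sum-map-iterate-suc h f x (suc k) =
  trans (cong (h x +_) (sum-map-iterate-suc h f (f x) k)) (sym (+-assoc (h x) _ _))

-- Multiplicities

δ : ∀ {n} → Fin n → Fin n → ℕ
δ x y = b2n (does (x Fin.≟ y))

δ-refl : ∀ {n} (x : Fin n) → δ x x ≡ 1
δ-refl x = cong b2n (dec-true (x Fin.≟ x) refl)

δ-≢ : ∀ {n} {x y : Fin n} → x ≢ y → δ x y ≡ 0
δ-≢ {x = x} {y} x≢y = cong b2n (dec-false (x Fin.≟ y) x≢y)

∑-δ : ∀ {n} (g : Fin n → ℕ) a → ∑[ x < n ] (g x * δ x a) ≡ g a
∑-δ {suc n} g zero = begin
  g zero * 1 + ∑[ x < n ] (g (suc x) * 0)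
    ≡⟨ cong₂ _+_ (*-identityʳ (g zero)) (∑-zero _ (*-zeroʳ ∘ g ∘ suc)) ⟩
  g zero + 0
    ≡⟨ +-identityʳ (g zero) ⟩
  g zero
    ∎
  where open ≡-Reasoning
∑-δ {suc n} g (suc a) =
  trans (cong (_+ ∑[ x < n ] (g (suc x) * δ x a)) (*-zeroʳ (g zero))) (∑-δ (g ∘ suc) a)

∑-δ-one : ∀ {n} (a : Fin n) → ∑[ x < n ] δ x a ≡ 1
∑-δ-one a = trans (sum-cong-≗ (λ x → sym (*-identityˡ (δ x a)))) (∑-δ (λ _ → 1) a)

multiplicity : ∀ {n} → Fin n → List (Fin n) → ℕ
multiplicity x []       = 0
multiplicity x (y ∷ ys) = δ x y + multiplicity x ys

IsEnumeration : ∀ {n} → List (Fin n) → Set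
IsEnumeration xs = ∀ x → multiplicity x xs ≡ 1

module _ {n : ℕ} where

  multiplicity-++ : ∀ (x : Fin n) xs ys →
                    multiplicity x (xs ++ ys) ≡ multiplicity x xs + multiplicity x ys
  multiplicity-++ x []       ys = refl
  multiplicity-++ x (y ∷ xs) ys =
    trans (cong (δ x y +_) (multiplicity-++ x xs ys)) (sym (+-assoc (δ x y) _ _))

  multiplicity-concatMap : ∀ {A : Set} (x : Fin n) (f : A → List (Fin n)) ms →
                           multiplicity x (concatMap f ms) ≡ sum (map (multiplicity x ∘ f) ms)
  multiplicity-concatMap x f []       = refl
  multiplicity-concatMap x f (m ∷ ms) =
    trans (multiplicity-++ x (f m) (concatMap f ms))
          (cong (multiplicity x (f m) +_) (multiplicity-concatMap x f ms))

  multiplicity-∉ : ∀ {x : Fin n} {xs} → x ∉ xs → multiplicity x xs ≡ 0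
  multiplicity-∉ {xs = []}     _   = refl
  multiplicity-∉ {xs = y ∷ ys} x∉ = cong₂ _+_ (δ-≢ (x∉ ∘ here)) (multiplicity-∉ (x∉ ∘ there))

  multiplicity-∈-Unique : ∀ {x : Fin n} {xs} → Unique xs → x ∈ xs → multiplicity x xs ≡ 1
  multiplicity-∈-Unique {x} (x∉ys ∷ _) (here refl) =
    cong₂ _+_ (δ-refl x) (multiplicity-∉ (λ x∈ys → All.lookup x∉ys x∈ys refl))
  multiplicity-∈-Unique (y∉ys ∷ u) (there x∈ys) =
    cong₂ _+_ (δ-≢ (λ x≡y → All.lookup y∉ys x∈ys (sym x≡y))) (multiplicity-∈-Unique u x∈ys)

  sum-map-multiplicity : ∀ (g : Fin n → ℕ) xs →
                         sum (map g xs) ≡ ∑[ x < n ] (g x * multiplicity x xs)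
  sum-map-multiplicity g []       = sym (∑-zero _ (*-zeroʳ ∘ g))
  sum-map-multiplicity g (a ∷ xs) = begin
    g a + sum (map g xs)
      ≡⟨ cong₂ _+_ (∑-δ g a) (sym (sum-map-multiplicity g xs)) ⟨
    ∑[ x < n ] (g x * δ x a) + ∑[ x < n ] (g x * multiplicity x xs)
      ≡⟨ ∑-distrib-+ (λ x → g x * δ x a) (λ x → g x * multiplicity x xs) ⟨
    ∑[ x < n ] (g x * δ x a + g x * multiplicity x xs)
      ≡⟨ sum-cong-≗ (λ x → *-distribˡ-+ (g x) (δ x a) _) ⟨
    ∑[ x < n ] (g x * multiplicity x (a ∷ xs))
      ∎
    where open ≡-Reasoning

  sum-map-enumeration : ∀ {xs} → IsEnumeration xs → ∀ (g : Fin n → ℕ) →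
                        sum (map g xs) ≡ ∑[ x < n ] g x
  sum-map-enumeration {xs} once g = trans (sum-map-multiplicity g xs)
    (sum-cong-≗ (λ x → trans (cong (g x *_) (once x)) (*-identityʳ (g x))))

∣m-n∣≡[m∸n]+[n∸m] : ∀ m n → ∣ m - n ∣ ≡ (m ∸ n) + (n ∸ m)
∣m-n∣≡[m∸n]+[n∸m] zero    n       = cong (_+ n) (sym (0∸n≡0 n))
∣m-n∣≡[m∸n]+[n∸m] (suc m) zero    = sym (+-identityʳ (suc m))
∣m-n∣≡[m∸n]+[n∸m] (suc m) (suc n) = ∣m-n∣≡[m∸n]+[n∸m] m n

m+[n∸m]≡n+[m∸n] : ∀ m n → m + (n ∸ m) ≡ n + (m ∸ n)
m+[n∸m]≡n+[m∸n] zero    n       = sym (trans (cong (n +_) (0∸n≡0 n)) (+-identityʳ n))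
m+[n∸m]≡n+[m∸n] (suc m) zero    = cong suc (+-identityʳ m)
m+[n∸m]≡n+[m∸n] (suc m) (suc n) = cong suc (m+[n∸m]≡n+[m∸n] m n)

<ᵇ-true : ∀ {m n} → m < n → (m <ᵇ n) ≡ true
<ᵇ-true = dec-true (_ <? _)

<ᵇ-false : ∀ {m n} → ¬ m < n → (m <ᵇ n) ≡ false
<ᵇ-false = dec-false (_ <? _)

≡ᵇ-false⇒≢ : ∀ {n} {x y : Fin n} → (toℕ x ≡ᵇ toℕ y) ≡ false → x ≢ y
≡ᵇ-false⇒≢ e x≡y = subst T e (≡⇒≡ᵇ _ _ (cong toℕ x≡y))

T-foldr-∧⁻ : ∀ {A : Set} (p : A → Bool) {xs} → T (foldr (λ y b → p y ∧ b) true xs) → All (T ∘ p) xs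
T-foldr-∧⁻ p {[]}     _ = []
T-foldr-∧⁻ p {x ∷ xs} t with px , pxs ← Equivalence.to T-∧ t = px ∷ T-foldr-∧⁻ p pxs

T-foldr-∧⁺ : ∀ {A : Set} (p : A → Bool) {xs} → All (T ∘ p) xs → T (foldr (λ y b → p y ∧ b) true xs)
T-foldr-∧⁺ p []         = _
T-foldr-∧⁺ p (px ∷ pxs) = Equivalence.from T-∧ (px , T-foldr-∧⁺ p pxs)

b2n-∧-false : ∀ p {b} → b ≡ false → b2n (p ∧ b) ≡ 0
b2n-∧-false p refl = cong b2n (∧-zeroʳ p)

b2n-∧-split : ∀ p q b → (T b → p ≡ not q) → b2n (p ∧ b) + b2n (q ∧ b) ≡ b2n b
b2n-∧-split p q false _ = cong₂ _+_ (cong b2n (∧-zeroʳ p)) (cong b2n (∧-zeroʳ q))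
b2n-∧-split p q true  p≡¬q with q | p≡¬q _
... | true  | refl = refl
... | false | refl = refl

between : ℕ → ℕ → ℕ → Bool
between lo hi x = (lo <ᵇ x) ∧ (x <ᵇ hi)

T-between : ∀ {lo hi x} → T (between lo hi x) → lo < x × x < hi
T-between {lo} {hi} {x} t with lo<x , x<hi ← Equivalence.to T-∧ t = <ᵇ⇒< lo x lo<x , <ᵇ⇒< x hi x<hi

between-empty : ∀ {lo hi} x → hi ≤ lo → between lo hi x ≡ false
between-empty {lo} {hi} x hi≤lo with lo <ᵇ x in e
... | false = refl
... | true  = <ᵇ-false (λ x<hi → <-irrefl refl (<-≤-trans (<-trans lo<x x<hi) hi≤lo))
  where lo<x = <ᵇ⇒< lo x (subst T (sym e) _)

count-below : ∀ {n} h → h ≤ n → ∑[ v < n ] b2n (toℕ v <ᵇ h) ≡ h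
count-below {zero}  zero    _         = refl
count-below {suc n} zero    _         = sum-replicate-zero (suc n)
count-below {suc n} (suc h) (s≤s h≤n) = cong suc (count-below h h≤n)

count-between : ∀ {n} lo hi → hi ≤ suc n → ∑[ v < n ] b2n (between lo hi (val v)) ≡ hi ∸ suc lo
count-between {zero}  lo       zero       _           = refl
count-between {zero}  lo       (suc zero) _           = sym (0∸n≡0 lo)
count-between {zero}  lo       (suc (suc _)) (s≤s ())
count-between {suc n} lo       zero       _           =
  ∑-zero {suc n} (λ v → b2n (between lo zero (val v))) (λ v → cong b2n (∧-zeroʳ (lo <ᵇ val v)))
count-between {suc n} zero     (suc hi)   (s≤s hi≤n)  = count-below hi hi≤n
count-between {suc n} (suc lo) (suc hi)   (s≤s hi≤1+n) = count-between lo hi hi≤1+n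

fallFrom : ℕ → List ℕ → ℕ
fallFrom a []       = 0
fallFrom a (x ∷ xs) = (a ∸ x) + fallFrom x xs

at-map-val-≤ : ∀ {n} (xs : List (Fin n)) k → at (map val xs) k ≤ n
at-map-val-≤ []       k       = z≤n
at-map-val-≤ (x ∷ xs) zero    = Fin.toℕ<n x
at-map-val-≤ (x ∷ xs) (suc k) = at-map-val-≤ xs k

descentAt : List ℕ → ℕ → ℕ
descentAt τ j = if suc j <ᵇ length τ then at τ j ∸ at τ (suc j) else 0

∑-descentAt : ∀ τ → ∑[ j < length τ ] descentAt τ (toℕ j) ≡ fallFrom 0 τ
∑-descentAt []      = refl
∑-descentAt (x ∷ τ) = trans (∑-descentAt-∷ x τ) (cong (_+ fallFrom x τ) (sym (0∸n≡0 x)))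
  where
    ∑-descentAt-∷ : ∀ x τ → ∑[ j < suc (length τ) ] descentAt (x ∷ τ) (toℕ j) ≡ fallFrom x τ
    ∑-descentAt-∷ x []      = refl
    ∑-descentAt-∷ x (y ∷ τ) = cong (x ∸ y +_) (∑-descentAt-∷ y τ)

-- Orbits and cycles of a permutation

module Cycles {n : ℕ} (σ : Permutation′ n) where

  σ^ : ℕ → Fin n → Fin n
  σ^ k x = iterate (σ ⟨$⟩ʳ_) x k

  σ^-suc : ∀ k x → σ^ (suc k) x ≡ σ ⟨$⟩ʳ σ^ k x
  σ^-suc zero    x = refl
  σ^-suc (suc k) x = σ^-suc k (σ ⟨$⟩ʳ x)

  σ^-+ : ∀ i j x → σ^ (i + j) x ≡ σ^ j (σ^ i x)
  σ^-+ zero    j x = refl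
  σ^-+ (suc i) j x = σ^-+ i j (σ ⟨$⟩ʳ x)

  σ^-injective : ∀ k {x y} → σ^ k x ≡ σ^ k y → x ≡ y
  σ^-injective zero    eq = eq
  σ^-injective (suc k) eq = σ-injective (σ^-injective k eq)
    where
      σ-injective : ∀ {x y} → σ ⟨$⟩ʳ x ≡ σ ⟨$⟩ʳ y → x ≡ y
      σ-injective eq = trans (sym (inverseˡ σ)) (trans (cong (σ ⟨$⟩ˡ_) eq) (inverseˡ σ))

  σ^-cancelˡ : ∀ i d x → σ^ i x ≡ σ^ (i + d) x → σ^ d x ≡ x
  σ^-cancelˡ i d x eq = sym (σ^-injective i (begin
    σ^ i x       ≡⟨ eq ⟩
    σ^ (i + d) x ≡⟨ cong (λ k → σ^ k x) (+-comm i d) ⟩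
    σ^ (d + i) x ≡⟨ σ^-+ d i x ⟩
    σ^ i (σ^ d x) ∎))
    where open ≡-Reasoning

  σ^-collision : ∀ {i j x} → i < j → σ^ i x ≡ σ^ j x → ∃[ d ] suc d ≤ j × σ^ (suc d) x ≡ x
  σ^-collision {i} {j} {x} i<j σⁱx≡σʲx with d , i+1+d≡j ← m≤n⇒∃[o]m+o≡n i<j =
    d , subst (suc d ≤_) (sym j≡i+[1+d]) (m≤n+m (suc d) i) ,
    σ^-cancelˡ i (suc d) x (trans σⁱx≡σʲx (cong (λ k → σ^ k x) j≡i+[1+d]))
    where
      j≡i+[1+d] : j ≡ i + suc d
      j≡i+[1+d] = trans (sym i+1+d≡j) (sym (+-suc i d))

  σ^-returns : ∀ x → ∃[ p ] p < n × σ^ (suc p) x ≡ x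
  σ^-returns x with i , j , i<j , σⁱx≡σʲx ← Fin.pigeonhole (n<1+n n) (λ (i : Fin (suc n)) → σ^ (toℕ i) x)
    with d , 1+d≤j , σᵈ⁺¹x≡x ← σ^-collision i<j σⁱx≡σʲx =
    d , ≤-trans 1+d≤j (≤-pred (Fin.toℕ<n j)) , σᵈ⁺¹x≡x

  orbitGo-first-return : ∀ fuel m x j → j < fuel → σ^ j x ≡ m →
    ∃[ r ] orbitGo σ fuel m x ≡ List.iterate (σ ⟨$⟩ʳ_) x r × σ^ r x ≡ m × (∀ {i} → i < r → σ^ i x ≢ m)
  orbitGo-first-return (suc k) m x j j<1+k σʲx≡m with toℕ x ≡ᵇ toℕ m in e | j
  ... | true  | _      = 0 , refl , Fin.toℕ-injective (≡ᵇ⇒≡ _ _ (subst T (sym e) _)) , λ ()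
  ... | false | zero   = ⊥-elim (≡ᵇ-false⇒≢ e σʲx≡m)
  ... | false | suc j′
    with r , walk , σʳ⁺¹x≡m , first ← orbitGo-first-return k m (σ ⟨$⟩ʳ x) j′ (≤-pred j<1+k) σʲx≡m =
    suc r , cong (x ∷_) walk , σʳ⁺¹x≡m ,
    λ { {zero} _ → ≡ᵇ-false⇒≢ e ; {suc i} i<1+r → first (≤-pred i<1+r) }

  record Cycle (m : Fin n) : Set where
    field
      r        : ℕ
      cycleOf≡ : cycleOf σ m ≡ List.iterate (σ ⟨$⟩ʳ_) m (suc r)
      closes   : σ^ (suc r) m ≡ m
      first    : ∀ {i} → i < r → σ^ (suc i) m ≢ m

  opaque
    cycle : ∀ m → Cycle m
    cycle m with p , p<n , σᵖ⁺¹m≡m ← σ^-returns m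
      with r , walk , closes , first ← orbitGo-first-return n m (σ ⟨$⟩ʳ m) p p<n σᵖ⁺¹m≡m =
      record { r = r ; cycleOf≡ = cong (m ∷_) walk ; closes = closes ; first = first }

  module _ (m : Fin n) where
    open Cycle (cycle m)

    cycleOf≡applyUpTo : cycleOf σ m ≡ applyUpTo (λ i → σ^ i m) (suc r)
    cycleOf≡applyUpTo = trans cycleOf≡ (iterate-applyUpTo (σ ⟨$⟩ʳ_) m (suc r))

    Unique-cycleOf : Unique (cycleOf σ m)
    Unique-cycleOf = subst Unique (sym cycleOf≡applyUpTo) (applyUpTo⁺₁ (λ i → σ^ i m) (suc r) distinct)
      where
        distinct : ∀ {i j} → i < j → j < suc r → σ^ i m ≢ σ^ j m
        distinct i<j j<1+r σⁱm≡σʲm with d , 1+d≤j , σᵈ⁺¹m≡m ← σ^-collision i<j σⁱm≡σʲm =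
          first (≤-trans 1+d≤j (≤-pred j<1+r)) σᵈ⁺¹m≡m

    σ^-mod : ∀ k → σ^ k m ≡ σ^ (k % suc r) m
    σ^-mod k = begin
      σ^ k m                            ≡⟨ cong (λ i → σ^ i m) (m≡m%n+[m/n]*n k (suc r)) ⟩
      σ^ (k % suc r + q * suc r) m      ≡⟨ cong (λ i → σ^ i m) (+-comm (k % suc r) (q * suc r)) ⟩
      σ^ (q * suc r + k % suc r) m      ≡⟨ σ^-+ (q * suc r) (k % suc r) m ⟩
      σ^ (k % suc r) (σ^ (q * suc r) m) ≡⟨ cong (σ^ (k % suc r)) (periodic q) ⟩
      σ^ (k % suc r) m                  ∎
      where
        open ≡-Reasoning
        q = k / suc r
        periodic : ∀ p → σ^ (p * suc r) m ≡ m
        periodic zero    = refl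
        periodic (suc p) =
          trans (σ^-+ (suc r) (p * suc r) m) (trans (cong (σ^ (p * suc r)) closes) (periodic p))

    ∈cycleOf⁻ : ∀ {x} → x ∈ cycleOf σ m → ∃[ i ] i < suc r × x ≡ σ^ i m
    ∈cycleOf⁻ {x} x∈ = ∈-applyUpTo⁻ (λ i → σ^ i m) (subst (x ∈_) cycleOf≡applyUpTo x∈)

  _∈Orbit_ : Fin n → Fin n → Set
  x ∈Orbit m = ∃[ k ] σ^ k m ≡ x

  ∈cycleOf⇒∈Orbit : ∀ {x m} → x ∈ cycleOf σ m → x ∈Orbit m
  ∈cycleOf⇒∈Orbit {m = m} x∈ with i , _ , x≡σⁱm ← ∈cycleOf⁻ m x∈ = i , sym x≡σⁱm

  ∈Orbit⇒∈cycleOf : ∀ {x m} → x ∈Orbit m → x ∈ cycleOf σ m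
  ∈Orbit⇒∈cycleOf {m = m} (k , refl) =
    subst₂ _∈_ (sym (σ^-mod m k)) (sym (cycleOf≡applyUpTo m))
      (∈-applyUpTo⁺ (λ i → σ^ i m) (m%n<n k (suc (Cycle.r (cycle m)))))

  ∈Orbit-refl : ∀ {m} → m ∈Orbit m
  ∈Orbit-refl = 0 , refl

  ∈Orbit-trans : ∀ {x y z} → y ∈Orbit x → z ∈Orbit y → z ∈Orbit x
  ∈Orbit-trans {x} (a , refl) (b , refl) = a + b , σ^-+ a b x

  ∈Orbit-sym : ∀ {x m} → x ∈Orbit m → m ∈Orbit x
  ∈Orbit-sym {x} {m} x∈ with i , i<1+r , x≡σⁱm ← ∈cycleOf⁻ m (∈Orbit⇒∈cycleOf x∈) =
    suc r ∸ i , (begin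
      σ^ (suc r ∸ i) x         ≡⟨ cong (σ^ (suc r ∸ i)) x≡σⁱm ⟩
      σ^ (suc r ∸ i) (σ^ i m)  ≡⟨ σ^-+ i (suc r ∸ i) m ⟨
      σ^ (i + (suc r ∸ i)) m   ≡⟨ cong (λ k → σ^ k m) (m+[n∸m]≡n (<⇒≤ i<1+r)) ⟩
      σ^ (suc r) m             ≡⟨ closes ⟩
      m                        ∎)
    where
      open Cycle (cycle m)
      open ≡-Reasoning

  isCycleMax⇒≤ : ∀ {m x} → T (isCycleMax σ m) → x ∈Orbit m → toℕ x ≤ toℕ m
  isCycleMax⇒≤ {m} max x∈ =
    ≤-pred (<ᵇ⇒< _ _ (All.lookup (T-foldr-∧⁻ (λ y → toℕ y <ᵇ suc (toℕ m)) max) (∈Orbit⇒∈cycleOf x∈)))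

  ≤⇒isCycleMax : ∀ {m} → (∀ {x} → x ∈Orbit m → toℕ x ≤ toℕ m) → T (isCycleMax σ m)
  ≤⇒isCycleMax {m} ≤m =
    T-foldr-∧⁺ (λ y → toℕ y <ᵇ suc (toℕ m)) (All.tabulate (λ y∈ → <⇒<ᵇ (s≤s (≤m (∈cycleOf⇒∈Orbit y∈)))))

  opaque
    cycleMax : Fin n → Fin n
    cycleMax x = argmax toℕ x (cycleOf σ x)

    cycleMax-∈Orbit : ∀ {x} → cycleMax x ∈Orbit x
    cycleMax-∈Orbit {x} = argmax-all toℕ {P = _∈Orbit x} ∈Orbit-refl (All.tabulate ∈cycleOf⇒∈Orbit)

    ≤cycleMax : ∀ {x y} → y ∈Orbit x → toℕ y ≤ toℕ (cycleMax x)
    ≤cycleMax {x} y∈ = All.lookup (f[xs]≤f[argmax] {f = toℕ} x (cycleOf σ x)) (∈Orbit⇒∈cycleOf y∈)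

  isCycleMax-cycleMax : ∀ x → T (isCycleMax σ (cycleMax x))
  isCycleMax-cycleMax x = ≤⇒isCycleMax (λ y∈ → ≤cycleMax (∈Orbit-trans cycleMax-∈Orbit y∈))

  cycleMax-unique : ∀ {m x} → T (isCycleMax σ m) → x ∈Orbit m → m ≡ cycleMax x
  cycleMax-unique max x∈ = Fin.toℕ-injective
    (≤-antisym (≤cycleMax (∈Orbit-sym x∈)) (isCycleMax⇒≤ max (∈Orbit-trans x∈ cycleMax-∈Orbit)))

  block : Fin n → List (Fin n)
  block m = if isCycleMax σ m then cycleOf σ m else []

  blocks : List (Fin n)
  blocks = concatMap block (allFin n)

  Φ≡map-val-blocks : Φ σ ≡ map val blocks
  Φ≡map-val-blocks =
    sym (trans (map-concatMap val block (allFin n)) (concatMap-cong map-val-block (allFin n)))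
    where
      map-val-block : ∀ m → map val (block m) ≡ (if isCycleMax σ m then map val (cycleOf σ m) else [])
      map-val-block m with isCycleMax σ m
      ... | true  = refl
      ... | false = refl

  multiplicity-block : ∀ x m → multiplicity x (block m) ≡ δ m (cycleMax x)
  multiplicity-block x m with isCycleMax σ m in e | m Fin.≟ cycleMax x
  ... | true  | yes refl  =
    multiplicity-∈-Unique (Unique-cycleOf m) (∈Orbit⇒∈cycleOf (∈Orbit-sym cycleMax-∈Orbit))
  ... | true  | no m≢max =
    multiplicity-∉ (λ x∈ → m≢max (cycleMax-unique (Equivalence.from T-≡ e) (∈cycleOf⇒∈Orbit x∈)))
  ... | false | yes refl  = ⊥-elim (subst T e (isCycleMax-cycleMax x))
  ... | false | no _      = refl

  blocks-enumerate : IsEnumeration blocks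
  blocks-enumerate x = begin
    multiplicity x blocks                          ≡⟨ multiplicity-concatMap x block (allFin n) ⟩
    sum (map (multiplicity x ∘ block) (allFin n))  ≡⟨ sum-map-allFin (multiplicity x ∘ block) ⟩
    ∑[ m < n ] multiplicity x (block m)            ≡⟨ sum-cong-≗ (multiplicity-block x) ⟩
    ∑[ m < n ] δ m (cycleMax x)                    ≡⟨ ∑-δ-one (cycleMax x) ⟩
    1                                              ∎
    where open ≡-Reasoning

  stepDown : Fin n → ℕ
  stepDown y = toℕ y ∸ toℕ (σ ⟨$⟩ʳ y)

  fallFrom-orbit++ : ∀ k x ys →
    fallFrom (val x) (map val (List.iterate (σ ⟨$⟩ʳ_) (σ ⟨$⟩ʳ x) k) ++ ys)
      ≡ sum (map stepDown (List.iterate (σ ⟨$⟩ʳ_) x k)) + fallFrom (val (σ^ k x)) ys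
  fallFrom-orbit++ zero    x ys = refl
  fallFrom-orbit++ (suc k) x ys =
    trans (cong (stepDown x +_) (fallFrom-orbit++ k (σ ⟨$⟩ʳ x) ys)) (sym (+-assoc (stepDown x) _ _))

  fallFrom-cycleOf++ : ∀ {a m} ys → T (isCycleMax σ m) → a ≤ val m → ∃[ y ] y ∈Orbit m ×
    fallFrom a (map val (cycleOf σ m) ++ ys) ≡ sum (map stepDown (cycleOf σ m)) + fallFrom (val y) ys
  fallFrom-cycleOf++ {a} {m} ys max a≤m = σ^ r m , (r , refl) , (begin
    fallFrom a (map val (cycleOf σ m) ++ ys)
      ≡⟨ cong (λ c → fallFrom a (map val c ++ ys)) cycleOf≡ ⟩
    (a ∸ val m) + fallFrom (val m) (map val (List.iterate (σ ⟨$⟩ʳ_) (σ ⟨$⟩ʳ m) r) ++ ys)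
      ≡⟨ cong₂ _+_ (m≤n⇒m∸n≡0 a≤m) (fallFrom-orbit++ r m ys) ⟩
    sum (map stepDown (List.iterate (σ ⟨$⟩ʳ_) m r)) + fallFrom (val (σ^ r m)) ys
      ≡⟨ cong (_+ fallFrom (val (σ^ r m)) ys) closing ⟨
    sum (map stepDown (List.iterate (σ ⟨$⟩ʳ_) m (suc r))) + fallFrom (val (σ^ r m)) ys
      ≡⟨ cong (λ c → sum (map stepDown c) + fallFrom (val (σ^ r m)) ys) cycleOf≡ ⟨
    sum (map stepDown (cycleOf σ m)) + fallFrom (val (σ^ r m)) ys
      ∎)
    where
      open Cycle (cycle m)
      open ≡-Reasoning
      S = sum (map stepDown (List.iterate (σ ⟨$⟩ʳ_) m r))
      stepDown-last≡0 : stepDown (σ^ r m) ≡ 0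
      stepDown-last≡0 = trans (cong (λ z → toℕ (σ^ r m) ∸ toℕ z) (trans (sym (σ^-suc r m)) closes))
                              (m≤n⇒m∸n≡0 (isCycleMax⇒≤ max (r , refl)))
      closing : sum (map stepDown (List.iterate (σ ⟨$⟩ʳ_) m (suc r))) ≡ S
      closing = trans (sum-map-iterate-suc stepDown (σ ⟨$⟩ʳ_) m r)
                      (trans (cong (S +_) stepDown-last≡0) (+-identityʳ S))

  fallFrom-blocks : ∀ {a} ms → AllPairs (λ m m′ → toℕ m < toℕ m′) ms → All (λ m → a ≤ val m) ms →
    fallFrom a (map val (concatMap block ms)) ≡ sum (map stepDown (concatMap block ms))
  fallFrom-blocks []       _                _            = refl
  fallFrom-blocks {a} (m ∷ ms) (m<ms ∷ sorted) (a≤m ∷ a≤ms) with isCycleMax σ m in e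
  ... | false = fallFrom-blocks ms sorted a≤ms
  ... | true
    with y , y∈ , fall≡ ← fallFrom-cycleOf++ (map val (concatMap block ms)) (Equivalence.from T-≡ e) a≤m
    = begin
    fallFrom a (map val (cycleOf σ m ++ concatMap block ms))
      ≡⟨ cong (fallFrom a) (map-++ val (cycleOf σ m) (concatMap block ms)) ⟩
    fallFrom a (map val (cycleOf σ m) ++ map val (concatMap block ms))
      ≡⟨ fall≡ ⟩
    sum (map stepDown (cycleOf σ m)) + fallFrom (val y) (map val (concatMap block ms))
      ≡⟨ cong (sum (map stepDown (cycleOf σ m)) +_) (fallFrom-blocks ms sorted (All.map y≤ m<ms)) ⟩
    sum (map stepDown (cycleOf σ m)) + sum (map stepDown (concatMap block ms))
      ≡⟨ sum-map-++ stepDown (cycleOf σ m) (concatMap block ms) ⟨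
    sum (map stepDown (cycleOf σ m ++ concatMap block ms))
      ∎
    where
      open ≡-Reasoning
      y≤ : ∀ {m′} → toℕ m < toℕ m′ → val y ≤ val m′
      y≤ m<m′ = s≤s (<⇒≤ (≤-<-trans (isCycleMax⇒≤ (Equivalence.from T-≡ e) y∈) m<m′))

  fallFrom-Φ : fallFrom 0 (Φ σ) ≡ ∑[ y < n ] stepDown y
  fallFrom-Φ = begin
    fallFrom 0 (Φ σ)               ≡⟨ cong (fallFrom 0) Φ≡map-val-blocks ⟩
    fallFrom 0 (map val blocks)    ≡⟨ fallFrom-blocks (allFin n) (tabulate⁺-< id) (All.tabulate λ _ → z≤n) ⟩
    sum (map stepDown blocks)      ≡⟨ sum-map-enumeration {xs = blocks} blocks-enumerate stepDown ⟩
    ∑[ y < n ] stepDown y          ∎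
    where open ≡-Reasoning

  stepUp : Fin n → ℕ
  stepUp y = toℕ (σ ⟨$⟩ʳ y) ∸ toℕ y

  ∑-stepUp≡∑-stepDown : ∑[ y < n ] stepUp y ≡ ∑[ y < n ] stepDown y
  ∑-stepUp≡∑-stepDown = +-cancelˡ-≡ (∑[ y < n ] toℕ y) _ _ (begin
    ∑[ y < n ] toℕ y + ∑[ y < n ] stepUp y
      ≡⟨ ∑-distrib-+ toℕ stepUp ⟨
    ∑[ y < n ] (toℕ y + stepUp y)
      ≡⟨ sum-cong-≗ (λ y → m+[n∸m]≡n+[m∸n] (toℕ y) (toℕ (σ ⟨$⟩ʳ y))) ⟩
    ∑[ y < n ] (toℕ (σ ⟨$⟩ʳ y) + stepDown y)
      ≡⟨ ∑-distrib-+ (toℕ ∘ (σ ⟨$⟩ʳ_)) stepDown ⟩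
    ∑[ y < n ] toℕ (σ ⟨$⟩ʳ y) + ∑[ y < n ] stepDown y
      ≡⟨ cong (_+ ∑[ y < n ] stepDown y) (∑-permute toℕ σ) ⟨
    ∑[ y < n ] toℕ y + ∑[ y < n ] stepDown y
      ∎)
    where open ≡-Reasoning

  displacement≡2*∑stepDown : displacement σ ≡ 2 * ∑[ y < n ] stepDown y
  displacement≡2*∑stepDown = begin
    displacement σ
      ≡⟨ sum-map-allFin (λ y → ∣ toℕ (σ ⟨$⟩ʳ y) - toℕ y ∣) ⟩
    ∑[ y < n ] ∣ toℕ (σ ⟨$⟩ʳ y) - toℕ y ∣
      ≡⟨ sum-cong-≗ (λ y → ∣m-n∣≡[m∸n]+[n∸m] (toℕ (σ ⟨$⟩ʳ y)) (toℕ y)) ⟩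
    ∑[ y < n ] (stepUp y + stepDown y)
      ≡⟨ ∑-distrib-+ stepUp stepDown ⟩
    ∑[ y < n ] stepUp y + ∑[ y < n ] stepDown y
      ≡⟨ cong (_+ ∑[ y < n ] stepDown y) ∑-stepUp≡∑-stepDown ⟩
    ∑[ y < n ] stepDown y + ∑[ y < n ] stepDown y
      ≡⟨ cong (∑[ y < n ] stepDown y +_) (+-identityʳ _) ⟨
    2 * ∑[ y < n ] stepDown y
      ∎
    where open ≡-Reasoning

-- Pattern occurrences in a permutation word

patternCount : List ℕ → ℕ
patternCount τ = pat21 τ + pat2-31 τ + pat31-2 τ

module PermutationWord {n : ℕ} (L : List (Fin n)) (L-enumerates : IsEnumeration L) where

  private
    τ : List ℕ
    τ = map val L
    N : ℕ
    N = length τ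
    t : ℕ → ℕ
    t = at τ

  inside : ℕ → ℕ → Bool
  inside j i = between (t (suc j)) (t j) (t i)

  -- In occ2-31 i j and occ31-2 j k the descent sits at positions j, j + 1; i and k carry the 2.
  occ21 : ℕ → ℕ
  occ21 j = b2n ((suc j <ᵇ N) ∧ (t (suc j) <ᵇ t j))

  occ2-31 : ℕ → ℕ → ℕ
  occ2-31 i j = b2n ((i <ᵇ j) ∧ (suc j <ᵇ N) ∧ inside j i)

  occ31-2 : ℕ → ℕ → ℕ
  occ31-2 j k = b2n ((suc j <ᵇ k) ∧ inside j k)

  insideBefore : ℕ → ℕ → ℕ
  insideBefore j i = b2n ((i <ᵇ j) ∧ inside j i)

  -- A position holding a value strictly inside the descent at j is neither j nor j + 1.
  insideBefore+occ31-2 : ∀ j k → insideBefore j k + occ31-2 j k ≡ b2n (inside j k)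
  insideBefore+occ31-2 j k = b2n-∧-split (k <ᵇ j) (suc j <ᵇ k) (inside j k) exclusive
    where
      exclusive : T (inside j k) → (k <ᵇ j) ≡ not (suc j <ᵇ k)
      exclusive ins with lo<tk , tk<hi ← T-between {t (suc j)} {t j} {t k} ins | <-cmp k j
      ... | tri< k<j _ _  = trans (<ᵇ-true k<j) (cong not (sym (<ᵇ-false (<-asym k<j ∘ <-trans (n<1+n j)))))
      ... | tri≈ _ refl _ = ⊥-elim (<-irrefl refl tk<hi)
      ... | tri> _ _ j<k with m≤n⇒m<n∨m≡n j<k
      ...   | inj₁ 1+j<k = trans (<ᵇ-false (<-asym j<k)) (cong not (sym (<ᵇ-true 1+j<k)))
      ...   | inj₂ refl  = ⊥-elim (<-irrefl refl lo<tk)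

  count-inside : ∀ j → t (suc j) < t j → ∑[ k < N ] b2n (inside j (toℕ k)) ≡ t j ∸ suc (t (suc j))
  count-inside j _ = begin
    ∑[ k < N ] b2n (inside j (toℕ k))        ≡⟨ sum-map-at (b2n ∘ between lo hi) τ ⟩
    sum (map (b2n ∘ between lo hi) τ)        ≡⟨ cong sum (map-∘ L) ⟨
    sum (map (b2n ∘ between lo hi ∘ val) L)  ≡⟨ sum-map-enumeration {xs = L} L-enumerates _ ⟩
    ∑[ v < n ] b2n (between lo hi (val v))   ≡⟨ count-between lo hi (m≤n⇒m≤1+n (at-map-val-≤ L j)) ⟩
    hi ∸ suc lo                              ∎
    where
      open ≡-Reasoning
      lo = t (suc j)
      hi = t j

  occurrences-at-descent : ∀ j →
    occ21 j + ∑[ i < N ] occ2-31 (toℕ i) j + ∑[ k < N ] occ31-2 j (toℕ k) ≡ descentAt τ j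
  occurrences-at-descent j with suc j <ᵇ N in j+1<N
  ... | false = cong₂ _+_
    (∑-zero {N} (λ i → b2n ((toℕ i <ᵇ j) ∧ false)) (λ i → b2n-∧-false (toℕ i <ᵇ j) refl))
    (∑-zero {N} (λ k → occ31-2 j (toℕ k)) after-end)
    where
      after-end : ∀ (k : Fin N) → occ31-2 j (toℕ k) ≡ 0
      after-end k = cong (λ b → b2n (b ∧ inside j (toℕ k)))
        (<ᵇ-false (λ j<k → subst T j+1<N (<⇒<ᵇ (<-trans j<k (Fin.toℕ<n k)))))
  ... | true with t (suc j) <ᵇ t j in descent
  ...   | false = trans
    (cong₂ _+_ (∑-zero {N} (insideBefore j ∘ toℕ) (λ i → b2n-∧-false (toℕ i <ᵇ j) (no-inside (toℕ i))))
               (∑-zero {N} (occ31-2 j ∘ toℕ) (λ k → b2n-∧-false (suc j <ᵇ toℕ k) (no-inside (toℕ k)))))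
    (sym (m≤n⇒m∸n≡0 hi≤lo))
    where
      hi≤lo : t j ≤ t (suc j)
      hi≤lo = ≮⇒≥ (λ lo<hi → subst T descent (<⇒<ᵇ lo<hi))
      no-inside : ∀ i → inside j i ≡ false
      no-inside i = between-empty (t i) hi≤lo
  ...   | true = begin
    suc (∑[ i < N ] insideBefore j (toℕ i) + ∑[ k < N ] occ31-2 j (toℕ k))
      ≡⟨ cong suc (∑-distrib-+ {N} (insideBefore j ∘ toℕ) (occ31-2 j ∘ toℕ)) ⟨
    suc (∑[ k < N ] (insideBefore j (toℕ k) + occ31-2 j (toℕ k)))
      ≡⟨ cong suc (sum-cong-≗ {N} (insideBefore+occ31-2 j ∘ toℕ)) ⟩
    suc (∑[ k < N ] b2n (inside j (toℕ k)))
      ≡⟨ cong suc (count-inside j lo<hi) ⟩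
    suc (t j ∸ suc (t (suc j)))
      ≡⟨ +-∸-assoc 1 lo<hi ⟨
    t j ∸ t (suc j)
      ∎
    where
      open ≡-Reasoning
      lo<hi : t (suc j) < t j
      lo<hi = <ᵇ⇒< _ _ (subst T (sym descent) _)

  patternCount≡fallFrom : patternCount τ ≡ fallFrom 0 τ
  patternCount≡fallFrom = begin
    pat21 τ + pat2-31 τ + pat31-2 τ
      ≡⟨ cong₂ _+_ (cong₂ _+_ pat21≡ pat2-31≡) pat31-2≡ ⟩
    ∑[ j < N ] occ21 (toℕ j) + ∑[ j < N ] ∑[ i < N ] occ2-31 (toℕ i) (toℕ j)
      + ∑[ j < N ] ∑[ k < N ] occ31-2 (toℕ j) (toℕ k)
      ≡⟨ cong (_+ ∑[ j < N ] ∑[ k < N ] occ31-2 (toℕ j) (toℕ k)) (∑-distrib-+ (occ21 ∘ toℕ) B) ⟨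
    ∑[ j < N ] (occ21 (toℕ j) + B j) + ∑[ j < N ] C j
      ≡⟨ ∑-distrib-+ (λ j → occ21 (toℕ j) + B j) C ⟨
    ∑[ j < N ] (occ21 (toℕ j) + B j + C j)
      ≡⟨ sum-cong-≗ {N} (occurrences-at-descent ∘ toℕ) ⟩
    ∑[ j < N ] descentAt τ (toℕ j)
      ≡⟨ ∑-descentAt τ ⟩
    fallFrom 0 τ
      ∎
    where
      open ≡-Reasoning
      B C : Fin N → ℕ
      B j = ∑[ i < N ] occ2-31 (toℕ i) (toℕ j)
      C j = ∑[ k < N ] occ31-2 (toℕ j) (toℕ k)
      pat21≡ : pat21 τ ≡ ∑[ j < N ] occ21 (toℕ j)
      pat21≡ = sum-map-upTo occ21 N
      pat2-31≡ : pat2-31 τ ≡ ∑[ j < N ] B j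
      pat2-31≡ = trans (sum-map-upTo _ N)
        (trans (sum-cong-≗ {N} (λ i → sum-map-upTo (occ2-31 (toℕ i)) N))
               (∑-comm {N} {N} (λ i j → occ2-31 (toℕ i) (toℕ j))))
      pat31-2≡ : pat31-2 τ ≡ ∑[ j < N ] C j
      pat31-2≡ = trans (sum-map-upTo _ N) (sum-cong-≗ {N} (λ j → sum-map-upTo (occ31-2 (toℕ j)) N))

patternCount-Φ≡fallFrom : ∀ {n} (σ : Permutation′ n) → patternCount (Φ σ) ≡ fallFrom 0 (Φ σ)
patternCount-Φ≡fallFrom σ = subst (λ τ → patternCount τ ≡ fallFrom 0 τ) (sym Φ≡map-val-blocks)
  (PermutationWord.patternCount≡fallFrom blocks blocks-enumerate)
  where open Cycles σ

theorem3p5 : ∀ (n : ℕ) (σ : Permutation′ n) →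
    displacement σ ≡ 2 * (pat21 (Φ σ) + pat2-31 (Φ σ) + pat31-2 (Φ σ))
theorem3p5 n σ = begin
  displacement σ             ≡⟨ displacement≡2*∑stepDown ⟩
  2 * ∑[ y < n ] stepDown y  ≡⟨ cong (2 *_) fallFrom-Φ ⟨
  2 * fallFrom 0 (Φ σ)       ≡⟨ cong (2 *_) (patternCount-Φ≡fallFrom σ) ⟨
  2 * patternCount (Φ σ)     ∎
  where
    open Cycles σ
    open ≡-Reasoning
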